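{- Let $r\le n$ and $d\le r+1$ be positive integers and $0\le k\le n$ with $n-k+1=d-1$. Let $S=\{s_1,\dots,s_n\}\subseteq\mathbb{F}_2^r$ with $|S|=n$, $\mathrm{Span}(S)=\mathbb{F}_2^r$, and such that any $d-1$ vectors of $S$ are linearly independent. Let $\Gamma=\mathsf{Cay}(\mathbb{F}_2^r,S)$. Then the relative minimum distance of $\mathcal{C}[\Gamma,k]$ satisfies \[\Delta_H(\mathcal{C}[\Gamma,k])\leq 2^{d-r-1}\Big(1-\frac{k-1}{n}\Big).\]
   Context: $\mathbb{F}$ is a finite field with $|\mathbb{F}|>n$, $x_1,\dots,x_n\in\mathbb{F}$ pairwise distinct, $\mathsf{RS}[n,k]:=\{(p(x_1),\dots,p(x_n)):p\in\mathbb{F}[X],\deg p<k\}$. $\mathsf{Cay}(\mathbb{F}_2^r,S)$ is the $n$-regular indexed multigraph $(V,E)$ with $V=\mathbb{F}_2^r$ and $E(v,\ell)=v+s_\ell$ for $v\in V,\ell\in[n]$. The relation $\sim_E$ on $V\times[n]$: $(v,\ell)\sim_E(v',\ell')$ iff $\ell=\ell'$ and ($E(v,\ell)=v'$ or $v=v'$); $\overline{E}$ is the set of its classes. $W(\Gamma,\mathbb{F})$ is the set of $f:V\times[n]\to\mathbb{F}$ with $f(v,\ell)=f(v',\ell)$ whenever $(v,\ell)\sim_E(v',\ell)$. $\mathcal{C}[\Gamma,k]:=\{f\in W(\Gamma,\mathbb{F}):\forall v\in V, (f(v,1),\dots,f(v,n))\in\mathsf{RS}[n,k]\}$. The relative Hamming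 weight of $f$ is $\frac{1}{|\overline{E}|}|\{\overline{(v,\ell)}\in\overline{E}: f(v,\ell)\neq0\}|$, and $\Delta_H(\mathcal{C}[\Gamma,k])$ is the minimum relative Hamming weight of a nonzero element of $\mathcal{C}[\Gamma,k]$. -}

module Defs where

open import Level using (Level; _⊔_) renaming (suc to lsuc)
open import Data.Nat using (ℕ; zero; suc; _∸_; _^_) renaming (_+_ to _+ℕ_)
open import Data.Bool using (Bool; true; false; if_then_else_; not; _∧_; _xor_)
open import Data.Fin using (Fin; toℕ) renaming (zero to fzero; suc to fsuc)
open import Data.Fin.Subset using (Subset; _⊆_; ⊥; ∣_∣)
open import Data.Vec using (Vec; []; _∷_; zipWith; replicate)
open import Data.List using (List; []; _∷_; map; concatMap; filter; length; _++_)
open import Data.List using () renaming (allFin to allFinL)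
open import Data.Product using (Σ; ∃; _×_; _,_)
open import Data.Integer using (+_)
open import Data.Rational using (ℚ; _/_) renaming (0ℚ to 0q)
open import Relation.Nullary using (¬_; does)
open import Relation.Binary using (Decidable)
open import Relation.Binary.PropositionalEquality as ≡ using (_≡_)
open import Algebra.Bundles using (CommutativeRing)
open import Function.Bundles using (Inverse)

record FiniteField (c ℓ : Level) : Set (lsuc (c ⊔ ℓ)) where
  field
    commutativeRing : CommutativeRing c ℓ
  open CommutativeRing commutativeRing public
  field
    1≉0   : ¬ (1# ≈ 0#)
    inv   : ∀ x → ¬ (x ≈ 0#) → Σ Carrier (λ y → (x * y) ≈ 1#)
    _≟_   : Decidable _≈_
    card  : ℕ
    enum  : Inverse (≡.setoid (Fin card)) setoid

F₂^ : ℕ → Set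
F₂^ r = Vec Bool r

0v : ∀ {r} → F₂^ r
0v = replicate _ false

infixl 6 _⊕_
_⊕_ : ∀ {r} → F₂^ r → F₂^ r → F₂^ r
_⊕_ = zipWith _xor_

allVecs : ∀ r → List (F₂^ r)
allVecs zero    = [] ∷ []
allVecs (suc r) = map (false ∷_) (allVecs r) ++ map (true ∷_) (allVecs r)

sumOver : ∀ {n r} → (Fin n → F₂^ r) → Subset n → F₂^ r
sumOver {zero}  s []      = 0v
sumOver {suc n} s (b ∷ T) = (if b then s fzero else 0v) ⊕ sumOver (λ i → s (fsuc i)) T

Spans : ∀ {n r} → (Fin n → F₂^ r) → Set
Spans s = ∀ v → Σ (Subset _) (λ T → sumOver s T ≡ v)

LinIndep : ∀ {n r} → (Fin n → F₂^ r) → Subset n → Set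
LinIndep s T = ∀ U → U ⊆ T → sumOver s U ≡ 0v → U ≡ ⊥

AnyLinIndep : ∀ {n r} → ℕ → (Fin n → F₂^ r) → Set
AnyLinIndep m s = ∀ T → ∣ T ∣ ≡ m → LinIndep s T

-- lexicographic ≤ on F₂^r (false < true), used to pick a canonical
-- representative of each ∼_E class
_≤lex_ : ∀ {r} → F₂^ r → F₂^ r → Bool
[]      ≤lex []      = true
(a ∷ u) ≤lex (b ∷ w) = if (a xor b) then (not a ∧ b) else (u ≤lex w)

count : ∀ {a} {A : Set a} → (A → Bool) → List A → ℕ
count p []       = 0
count p (x ∷ xs) = (if p x then 1 else 0) +ℕ count p xs

-- m / e as a rational (with the convention m / 0 = 0, never used here)
_/ℕ_ : ℕ → ℕ → ℚ
m /ℕ zero  = 0q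
m /ℕ suc e = (+ m) / suc e

module Code {c ℓ} (F : FiniteField c ℓ) where
  open FiniteField F

  ΣF : ∀ {k} → (Fin k → Carrier) → Carrier
  ΣF {zero}  f = 0#
  ΣF {suc k} f = f fzero + ΣF (λ j → f (fsuc j))

  pow : Carrier → ℕ → Carrier
  pow a zero    = 1#
  pow a (suc m) = a * pow a m

  InRS : ∀ {n} (k : ℕ) → (Fin n → Carrier) → (Fin n → Carrier) → Set (c ⊔ ℓ)
  InRS k x w = Σ (Fin k → Carrier) λ cf →
                 ∀ i → w i ≈ ΣF (λ j → cf j * pow (x i) (toℕ j))

  Fn : ℕ → ℕ → Set c
  Fn r n = F₂^ r → Fin n → Carrier

  -- f ∈ W(Γ,F) for Γ = Cay(F₂^r,S), E(v,ℓ) = v + s_ℓ: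
  -- f is constant on ∼_E classes, i.e. f(v,ℓ) = f(E(v,ℓ),ℓ)
  InW : ∀ {r n} → (Fin n → F₂^ r) → Fn r n → Set ℓ
  InW s f = ∀ v l → f v l ≈ f (v ⊕ s l) l

  InCode : ∀ {r n} (k : ℕ) → (Fin n → Carrier) → (Fin n → F₂^ r) → Fn r n → Set (c ⊔ ℓ)
  InCode k x s f = InW s f × (∀ v → InRS k x (f v))

  Nonzero : ∀ {r n} → Fn r n → Set ℓ
  Nonzero f = ∃ λ v → ∃ λ l → ¬ (f v l ≈ 0#)

  allPairs : ∀ r n → List (F₂^ r × Fin n)
  allPairs r n = concatMap (λ v → map (v ,_) (allFinL n)) (allVecs r)

  -- the ∼_E class of (v,ℓ) is {(v,ℓ),(v+s_ℓ,ℓ)}; we count each class once,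
  -- via its lexicographically smallest element.
  isRep : ∀ {r n} → (Fin n → F₂^ r) → F₂^ r × Fin n → Bool
  isRep s (v , l) = v ≤lex (v ⊕ s l)

  numClasses : ∀ {r n} → (Fin n → F₂^ r) → ℕ
  numClasses {r} {n} s = count (isRep s) (allPairs r n)

  numNonzeroClasses : ∀ {r n} → (Fin n → F₂^ r) → Fn r n → ℕ
  numNonzeroClasses {r} {n} s f =
    count (λ p → isRep s p ∧ not (does (f (Data.Product.proj₁ p) (Data.Product.proj₂ p) ≟ 0#)))
          (allPairs r n)

  relWeight : ∀ {r n} → (Fin n → F₂^ r) → Fn r n → ℚ
  relWeight s f = numNonzeroClasses s f /ℕ numClasses s

-- Put m = d - 1 and t = k - 1, so that m + t = n, and take as support the last m
-- coordinates. The polynomial g = ∏ (X - x_l) over the other t coordinates has degree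
-- t < k and vanishes exactly off the support. With U the span of the s_l in the
-- support (at most 2^m vectors), the word f(v, l) = g(x_l) for v ∈ U and 0 otherwise
-- is constant on every edge {v, v + s_l}: U is closed under + s_l when l is in the
-- support, and g(x_l) = 0 otherwise. Its rows are Reed-Solomon codewords and
-- f(0, l) ≠ 0 on the support. Each support direction contributes at most 2^(m-1) edges
-- inside U, so f is nonzero on at most m 2^(m-1) edges, while the graph has n 2^(r-1)
-- edges because independence of any m vectors of S rules out s_l = 0. The ratio is
-- 2^(m-r) m/n = 2^(d-r-1) (1 - (k-1)/n).

module Submission where

open import Defs
open import Data.Bool using (Bool)
open import Data.Fin using (Fin)
open import Data.Nat using (ℕ)
open import Relation.Binary.PropositionalEquality using (_≡_)

module Polynomial {c ℓ} (F : FiniteField c ℓ) where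
  open import Data.Nat using (zero; suc; _≤_; z≤n; s≤s)
  import Data.Nat.Properties as ℕP
  open import Data.Fin using (toℕ) renaming (zero to fzero; suc to fsuc)
  open import Data.List using (List; []; _∷_; length)
  open import Data.List.Membership.Propositional using (_∈_)
  open import Data.List.Relation.Unary.Any using (here; there)
  open import Data.Product using (_,_)
  open import Function using (_∘_)
  open import Relation.Nullary using (¬_)
  open import Relation.Binary.PropositionalEquality using (refl)
  open FiniteField F renaming (refl to ≈-refl; sym to ≈-sym; trans to ≈-trans)
  open Code F using (ΣF; pow; InRS)
  open import Relation.Binary.Reasoning.Setoid setoid
  open import Algebra.Properties.Ring ring using (x∙y⁻¹≈ε⇒x≈y; -‿distribˡ-*)
  open import Algebra.Properties.CommutativeSemigroup *-commutativeSemigroup using (x∙yz≈y∙xz)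

  -- polynomials as coefficient lists, constant term first
  eval : List Carrier → Carrier → Carrier
  eval []      x = 0#
  eval (a ∷ p) x = a + x * eval p x

  addConst : Carrier → List Carrier → List Carrier
  addConst b []      = b ∷ []
  addConst b (a ∷ p) = (b + a) ∷ p

  -- (X - a) · (b + X q) = - a b + X (b + (X - a) q)
  mulLinear : Carrier → List Carrier → List Carrier
  mulLinear a []      = []
  mulLinear a (b ∷ q) = - (a * b) ∷ addConst b (mulLinear a q)

  vanishingPoly : List Carrier → List Carrier
  vanishingPoly []       = 1# ∷ []
  vanishingPoly (a ∷ as) = mulLinear a (vanishingPoly as)

  eval-addConst : ∀ b p x → eval (addConst b p) x ≈ b + eval p x
  eval-addConst b []      x = +-congˡ (zeroʳ x)
  eval-addConst b (a ∷ p) x = +-assoc b a (x * eval p x)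

  eval-mulLinear : ∀ a p x → eval (mulLinear a p) x ≈ (x - a) * eval p x
  eval-mulLinear a []      x = ≈-sym (zeroʳ (x - a))
  eval-mulLinear a (b ∷ q) x = begin
    - (a * b) + x * eval (addConst b (mulLinear a q)) x
      ≈⟨ +-congˡ (*-congˡ (≈-trans (eval-addConst b (mulLinear a q) x) (+-congˡ (eval-mulLinear a q x)))) ⟩
    - (a * b) + x * (b + (x - a) * Q)
      ≈⟨ +-congˡ (distribˡ x b _) ⟩
    - (a * b) + (x * b + x * ((x - a) * Q))
      ≈⟨ +-assoc _ _ _ ⟨
    (- (a * b) + x * b) + x * ((x - a) * Q)
      ≈⟨ +-cong (+-comm _ _) (x∙yz≈y∙xz x (x - a) Q) ⟩
    (x * b + - (a * b)) + (x - a) * (x * Q)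
      ≈⟨ +-congʳ (≈-trans (+-congˡ (-‿distribˡ-* a b)) (≈-sym (distribʳ b x (- a)))) ⟩
    (x - a) * b + (x - a) * (x * Q)
      ≈⟨ distribˡ (x - a) b (x * Q) ⟨
    (x - a) * (b + x * Q) ∎
    where Q = eval q x

  length-addConst : ∀ b p {n} → length p ≤ suc n → length (addConst b p) ≤ suc n
  length-addConst b []      _   = s≤s z≤n
  length-addConst b (a ∷ p) p≤n = p≤n

  length-mulLinear : ∀ a p → length (mulLinear a p) ≤ suc (length p)
  length-mulLinear a []      = z≤n
  length-mulLinear a (b ∷ q) = s≤s (length-addConst b (mulLinear a q) (length-mulLinear a q))

  length-vanishingPoly : ∀ as → length (vanishingPoly as) ≤ suc (length as)
  length-vanishingPoly []       = ℕP.≤-refl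
  length-vanishingPoly (a ∷ as) = ℕP.≤-trans (length-mulLinear a (vanishingPoly as)) (s≤s (length-vanishingPoly as))

  eval-vanishingPoly-root : ∀ {x as} → x ∈ as → eval (vanishingPoly as) x ≈ 0#
  eval-vanishingPoly-root {x} {a ∷ as} x∈ = begin
    eval (mulLinear a (vanishingPoly as)) x  ≈⟨ eval-mulLinear a (vanishingPoly as) x ⟩
    (x - a) * eval (vanishingPoly as) x      ≈⟨ factor≈0 x∈ ⟩
    0#                                       ∎
    where
    factor≈0 : x ∈ a ∷ as → (x - a) * eval (vanishingPoly as) x ≈ 0#
    factor≈0 (here refl) = ≈-trans (*-congʳ (-‿inverseʳ x)) (zeroˡ _)
    factor≈0 (there x∈)  = ≈-trans (*-congˡ (eval-vanishingPoly-root x∈)) (zeroʳ _)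

  *-≉0 : ∀ {a b} → ¬ a ≈ 0# → ¬ b ≈ 0# → ¬ (a * b) ≈ 0#
  *-≉0 {a} {b} a≉0 b≉0 ab≈0 with inv a a≉0
  ... | a⁻¹ , aa⁻¹≈1 = b≉0 (begin
    b              ≈⟨ *-identityˡ b ⟨
    1# * b         ≈⟨ *-congʳ (≈-trans (≈-sym aa⁻¹≈1) (*-comm a a⁻¹)) ⟩
    (a⁻¹ * a) * b  ≈⟨ *-assoc a⁻¹ a b ⟩
    a⁻¹ * (a * b)  ≈⟨ *-congˡ ab≈0 ⟩
    a⁻¹ * 0#       ≈⟨ zeroʳ a⁻¹ ⟩
    0#             ∎)

  eval-vanishingPoly-nonroot : ∀ {x} as → (∀ {a} → a ∈ as → ¬ x ≈ a) → ¬ eval (vanishingPoly as) x ≈ 0#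
  eval-vanishingPoly-nonroot {x} []       _  = 1≉0 ∘ ≈-trans (≈-trans (≈-sym (+-identityʳ 1#)) (+-congˡ (≈-sym (zeroʳ x))))
  eval-vanishingPoly-nonroot {x} (a ∷ as) x∉ =
    *-≉0 (x∉ (here refl) ∘ x∙y⁻¹≈ε⇒x≈y x a) (eval-vanishingPoly-nonroot as (x∉ ∘ there))
      ∘ ≈-trans (≈-sym (eval-mulLinear a (vanishingPoly as) x))

  coeff : ∀ {k} → List Carrier → Fin k → Carrier
  coeff []      j        = 0#
  coeff (a ∷ p) fzero    = a
  coeff (a ∷ p) (fsuc j) = coeff p j

  ΣF-zero : ∀ {k} (f : Fin k → Carrier) → (∀ j → f j ≈ 0#) → ΣF f ≈ 0#
  ΣF-zero {zero}  f f≈0 = ≈-refl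
  ΣF-zero {suc k} f f≈0 = ≈-trans (+-cong (f≈0 fzero) (ΣF-zero (f ∘ fsuc) (f≈0 ∘ fsuc))) (+-identityʳ 0#)

  ΣF-*-distribˡ : ∀ {k} (g h : Fin k → Carrier) x → ΣF (λ j → g j * (x * h j)) ≈ x * ΣF (λ j → g j * h j)
  ΣF-*-distribˡ {zero}  g h x = ≈-sym (zeroʳ x)
  ΣF-*-distribˡ {suc k} g h x = begin
    g fzero * (x * h fzero) + ΣF (λ j → g (fsuc j) * (x * h (fsuc j)))
      ≈⟨ +-cong (x∙yz≈y∙xz (g fzero) x (h fzero)) (ΣF-*-distribˡ (g ∘ fsuc) (h ∘ fsuc) x) ⟩
    x * (g fzero * h fzero) + x * ΣF (λ j → g (fsuc j) * h (fsuc j))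
      ≈⟨ distribˡ x _ _ ⟨
    x * (g fzero * h fzero + ΣF (λ j → g (fsuc j) * h (fsuc j))) ∎

  ΣF-coeff : ∀ {k} p x → length p ≤ k → ΣF {k} (λ j → coeff p j * pow x (toℕ j)) ≈ eval p x
  ΣF-coeff {zero}  []      x _         = ≈-refl
  ΣF-coeff {suc k} []      x _         = ΣF-zero {suc k} _ (λ j → zeroˡ (pow x (toℕ j)))
  ΣF-coeff {suc k} (a ∷ p) x (s≤s p≤k) = begin
    a * 1# + ΣF {k} (λ j → coeff p j * (x * pow x (toℕ j)))
      ≈⟨ +-cong (*-identityʳ a) (ΣF-*-distribˡ {k} (coeff p) (λ j → pow x (toℕ j)) x) ⟩
    a + x * ΣF {k} (λ j → coeff p j * pow x (toℕ j))
      ≈⟨ +-congˡ (*-congˡ (ΣF-coeff p x p≤k)) ⟩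
    a + x * eval p x ∎

  eval∈RS : ∀ {n k} (x : Fin n → Carrier) p → length p ≤ k → InRS k x (λ i → eval p (x i))
  eval∈RS x p p≤k = coeff p , λ i → ≈-sym (ΣF-coeff p (x i) p≤k)

  0∈RS : ∀ {n} k (x : Fin n → Carrier) → InRS k x (λ _ → 0#)
  0∈RS k x = (λ _ → 0#) , λ i → ≈-sym (ΣF-zero {k} _ (λ j → zeroˡ _))

module Combinatorics where
  open import Data.Bool as Bool using (true; false; if_then_else_; not)
  import Data.Bool.Properties as BoolP
  open import Data.Nat using (zero; suc; pred; _+_; _*_; _∸_; _^_; _≤_; _<_; _≤ᵇ_; _<ᵇ_; z≤n; s≤s)
  import Data.Nat.Properties as ℕP
  open import Data.Fin using (toℕ; fromℕ<) renaming (zero to fzero; suc to fsuc)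
  import Data.Fin.Properties as FinP
  open import Data.Vec using ([]; _∷_)
  import Data.Vec.Properties as VecP
  open import Data.List using (List; []; _∷_; _++_; map; length; concatMap; filterᵇ; tabulate; allFin)
  open import Data.Fin.Subset using (Subset; ⊥; ⁅_⁆; ∣_∣; inside) renaming (_∈_ to _∈ₛ_)
  import Data.Fin.Subset.Properties as SubsetP
  open import Data.Nat.ListAction using (sum)
  import Data.List.Properties as ListP
  open import Data.List.Relation.Unary.Any using (here; there; _─_)
  open import Data.List.Relation.Unary.All as All using ([]; _∷_)
  open import Data.List.Relation.Unary.Unique.Propositional using (Unique; []; _∷_)
  import Data.List.Relation.Unary.Unique.Propositional.Properties as UniqueP
  open import Data.List.Membership.Propositional using (_∈_)
  open import Data.List.Membership.Propositional.Properties using (∈-map⁺; ∈-map⁻; ∈-++⁺ˡ; ∈-++⁺ʳ; ∈-++⁻)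
  open import Data.Product using (Σ; ∃-syntax; _×_; _,_)
  open import Data.Sum as Sum using (_⊎_; inj₁; inj₂)
  open import Relation.Nullary using (¬_)
  open import Function.Bundles using (Equivalence)
  open import Relation.Binary using (DecidableEquality)
  open import Data.Empty using (⊥-elim)
  open import Relation.Binary.PropositionalEquality
    using (_≢_; refl; sym; trans; cong; cong₂; subst; module ≡-Reasoning)
  open import Function using (_∘_)
  open import Data.Nat.Tactic.RingSolver using (solve-∀)
  open import Algebra.Properties.CommutativeSemigroup ℕP.+-commutativeSemigroup
    using () renaming (interchange to +-interchange)

  count-++ : ∀ {A : Set} (p : A → Bool) xs ys → count p (xs ++ ys) ≡ count p xs + count p ys
  count-++ p []       ys = refl
  count-++ p (x ∷ xs) ys =
    trans (cong ((if p x then 1 else 0) +_) (count-++ p xs ys)) (sym (ℕP.+-assoc (if p x then 1 else 0) _ _))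

  count-map : ∀ {A B : Set} (p : B → Bool) (g : A → B) xs → count p (map g xs) ≡ count (p ∘ g) xs
  count-map p g []       = refl
  count-map p g (x ∷ xs) = cong ((if p (g x) then 1 else 0) +_) (count-map p g xs)

  count-cong : ∀ {A : Set} {p q : A → Bool} → (∀ x → p x ≡ q x) → ∀ xs → count p xs ≡ count q xs
  count-cong p≗q []       = refl
  count-cong p≗q (x ∷ xs) = cong₂ (λ b c → (if b then 1 else 0) + c) (p≗q x) (count-cong p≗q xs)

  count-true : ∀ {A : Set} (xs : List A) → count (λ _ → true) xs ≡ length xs
  count-true []       = refl
  count-true (x ∷ xs) = cong suc (count-true xs)

  count-false : ∀ {A : Set} (xs : List A) → count (λ _ → false) xs ≡ 0
  count-false []       = refl
  count-false (x ∷ xs) = count-false xs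

  count+count-not : ∀ {A : Set} (p : A → Bool) xs → count p xs + count (not ∘ p) xs ≡ length xs
  count+count-not p []       = refl
  count+count-not p (x ∷ xs) with p x
  ... | true  = cong suc (count+count-not p xs)
  ... | false = trans (ℕP.+-suc _ _) (cong suc (count+count-not p xs))

  length-filterᵇ : ∀ {A : Set} (p : A → Bool) xs → length (filterᵇ p xs) ≡ count p xs
  length-filterᵇ p []       = refl
  length-filterᵇ p (x ∷ xs) with p x
  ... | true  = cong suc (length-filterᵇ p xs)
  ... | false = length-filterᵇ p xs

  ∈-─ : ∀ {A : Set} {x y : A} {ys} (x∈ : x ∈ ys) → y ∈ ys → y ≢ x → y ∈ (ys ─ x∈)
  ∈-─ (here refl) (here refl) y≢x = ⊥-elim (y≢x refl)
  ∈-─ (here refl) (there y∈)  _   = y∈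
  ∈-─ (there x∈)  (here refl) _   = here refl
  ∈-─ (there x∈)  (there y∈)  y≢x = there (∈-─ x∈ y∈ y≢x)

  count≤length : ∀ {A : Set} (p : A → Bool) {xs ys : List A} → Unique xs →
                 (∀ {x} → x ∈ xs → p x ≡ true → x ∈ ys) → count p xs ≤ length ys
  count≤length p {[]}     _          _   = z≤n
  count≤length p {x ∷ xs} {ys} (x∉xs ∷ uxs) sub with p x in px
  ... | false = count≤length p uxs (sub ∘ there)
  ... | true  = subst (suc (count p xs) ≤_) (sym (ListP.length-removeAt′ ys _))
                  (s≤s (count≤length p uxs λ y∈ py → ∈-─ x∈ys (sub (there y∈) py) (x≢y y∈ ∘ sym)))
    where
    x∈ys : x ∈ ys
    x∈ys = sub (here refl) px
    x≢y : ∀ {y} → y ∈ xs → x ≢ y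
    x≢y = All.lookup x∉xs

  count≡sum-map : ∀ {A : Set} (p : A → Bool) xs → count p xs ≡ sum (map (λ x → if p x then 1 else 0) xs)
  count≡sum-map p []       = refl
  count≡sum-map p (x ∷ xs) = cong (_ +_) (count≡sum-map p xs)

  sum-map-0 : ∀ {A : Set} (xs : List A) → sum (map (λ _ → 0) xs) ≡ 0
  sum-map-0 []       = refl
  sum-map-0 (x ∷ xs) = sum-map-0 xs

  sum-map-+ : ∀ {A : Set} (f g : A → ℕ) xs →
    sum (map (λ x → f x + g x) xs) ≡ sum (map f xs) + sum (map g xs)
  sum-map-+ f g []       = refl
  sum-map-+ f g (x ∷ xs) = begin
    (f x + g x) + sum (map (λ x → f x + g x) xs)    ≡⟨ cong ((f x + g x) +_) (sum-map-+ f g xs) ⟩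
    (f x + g x) + (sum (map f xs) + sum (map g xs)) ≡⟨ +-interchange (f x) (g x) _ _ ⟩
    (f x + sum (map f xs)) + (g x + sum (map g xs)) ∎
    where open ≡-Reasoning

  sum-map-mono-≤ : ∀ {A : Set} {f g : A → ℕ} → (∀ x → f x ≤ g x) → ∀ xs → sum (map f xs) ≤ sum (map g xs)
  sum-map-mono-≤ f≤g []       = z≤n
  sum-map-mono-≤ f≤g (x ∷ xs) = ℕP.+-mono-≤ (f≤g x) (sum-map-mono-≤ f≤g xs)

  sum-map-if : ∀ {A : Set} (p : A → Bool) b xs → sum (map (λ x → if p x then b else 0) xs) ≡ count p xs * b
  sum-map-if p b []       = refl
  sum-map-if p b (x ∷ xs) with p x
  ... | true  = cong (b +_) (sum-map-if p b xs)
  ... | false = sum-map-if p b xs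

  *-sum-map-const : ∀ {A : Set} (f : A → ℕ) a c → (∀ x → a * f x ≡ c) → ∀ xs → a * sum (map f xs) ≡ length xs * c
  *-sum-map-const f a c af≡c []       = ℕP.*-zeroʳ a
  *-sum-map-const f a c af≡c (x ∷ xs) = trans (ℕP.*-distribˡ-+ a (f x) _) (cong₂ _+_ (af≡c x) (*-sum-map-const f a c af≡c xs))

  count-pairs : ∀ {A B : Set} (P : A × B → Bool) xs ys →
    count P (concatMap (λ x → map (x ,_) ys) xs) ≡ sum (map (λ y → count (λ x → P (x , y)) xs) ys)
  count-pairs P []       ys = sym (sum-map-0 ys)
  count-pairs P (x ∷ xs) ys = begin
    count P (map (x ,_) ys ++ concatMap (λ x → map (x ,_) ys) xs)
      ≡⟨ count-++ P (map (x ,_) ys) _ ⟩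
    count P (map (x ,_) ys) + count P (concatMap (λ x → map (x ,_) ys) xs)
      ≡⟨ cong₂ _+_ (trans (count-map P (x ,_) ys) (count≡sum-map _ ys)) (count-pairs P xs ys) ⟩
    sum (map (λ y → if P (x , y) then 1 else 0) ys) + sum (map (λ y → count (λ x → P (x , y)) xs) ys)
      ≡⟨ sum-map-+ (λ y → if P (x , y) then 1 else 0) (λ y → count (λ x → P (x , y)) xs) ys ⟨
    sum (map (λ y → count (λ x → P (x , y)) (x ∷ xs)) ys) ∎
    where open ≡-Reasoning

  length-allFin : ∀ n → length (allFin n) ≡ n
  length-allFin n = ListP.length-tabulate {n = n} (λ i → i)

  count-≤ᵇ-allFin : ∀ n t → count (λ i → t ≤ᵇ toℕ i) (allFin n) ≡ n ∸ t
  count-≤ᵇ-allFin zero    t       = sym (ℕP.0∸n≡0 t)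
  count-≤ᵇ-allFin (suc n) zero    = cong suc (trans (count-true (tabulate {n = n} fsuc)) (ListP.length-tabulate {n = n} fsuc))
  count-≤ᵇ-allFin (suc n) (suc t) = begin
    count (λ i → suc t ≤ᵇ toℕ i) (tabulate {n = n} fsuc) ≡⟨ cong (count _) (ListP.map-tabulate {n = n} (λ i → i) fsuc) ⟨
    count (λ i → suc t ≤ᵇ toℕ i) (map fsuc (allFin n))  ≡⟨ count-map _ fsuc (allFin n) ⟩
    count (λ i → t <ᵇ suc (toℕ i)) (allFin n)           ≡⟨ count-cong (λ i → <ᵇ-suc t (toℕ i)) (allFin n) ⟩
    count (λ i → t ≤ᵇ toℕ i) (allFin n)                 ≡⟨ count-≤ᵇ-allFin n t ⟩
    n ∸ t                                               ∎
    where
    open ≡-Reasoning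
    <ᵇ-suc : ∀ t x → (t <ᵇ suc x) ≡ (t ≤ᵇ x)
    <ᵇ-suc zero    x = refl
    <ᵇ-suc (suc t) x = refl

  threshold-count : ∀ {n m t} → m + t ≡ n → count (λ i → t ≤ᵇ toℕ i) (allFin n) ≡ m
  threshold-count {n} {m} {t} m+t≡n =
    trans (count-≤ᵇ-allFin n t) (trans (cong (_∸ t) (sym m+t≡n)) (ℕP.m+n∸n≡m m t))

  threshold-count-not : ∀ {n m t} → m + t ≡ n → count (not ∘ (λ i → t ≤ᵇ toℕ i)) (allFin n) ≡ t
  threshold-count-not {n} {m} {t} m+t≡n = ℕP.+-cancelˡ-≡ m _ t (begin
    m + count (not ∘ p) (allFin n)                  ≡⟨ cong (_+ count (not ∘ p) (allFin n)) (threshold-count m+t≡n) ⟨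
    count p (allFin n) + count (not ∘ p) (allFin n) ≡⟨ count+count-not p (allFin n) ⟩
    length (allFin n)                               ≡⟨ length-allFin n ⟩
    n                                               ≡⟨ m+t≡n ⟨
    m + t                                           ∎)
    where
    open ≡-Reasoning
    p : Fin n → Bool
    p i = t ≤ᵇ toℕ i

  threshold-last : ∀ {n m t} → 1 ≤ m → m + t ≡ n → Σ (Fin n) λ l → (t ≤ᵇ toℕ l) ≡ true
  threshold-last {n} {m} {t} 1≤m m+t≡n =
    fromℕ< t<n , trans (cong (t ≤ᵇ_) (FinP.toℕ-fromℕ< t<n)) (Equivalence.to BoolP.T-≡ (ℕP.≤⇒≤ᵇ (ℕP.≤-refl {t})))
    where
    t<n : t < n
    t<n = subst (t <_) m+t≡n (ℕP.m<n+m t 1≤m)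

  ⊕-comm : ∀ {r} (u v : F₂^ r) → u ⊕ v ≡ v ⊕ u
  ⊕-comm = VecP.zipWith-comm BoolP.xor-comm

  ⊕-assoc : ∀ {r} (u v w : F₂^ r) → (u ⊕ v) ⊕ w ≡ u ⊕ (v ⊕ w)
  ⊕-assoc = VecP.zipWith-assoc BoolP.xor-assoc

  ⊕-identityˡ : ∀ {r} (u : F₂^ r) → 0v ⊕ u ≡ u
  ⊕-identityˡ = VecP.zipWith-identityˡ BoolP.xor-identityˡ

  ⊕-identityʳ : ∀ {r} (u : F₂^ r) → u ⊕ 0v ≡ u
  ⊕-identityʳ = VecP.zipWith-identityʳ BoolP.xor-identityʳ

  ⊕-self : ∀ {r} (u : F₂^ r) → u ⊕ u ≡ 0v
  ⊕-self []      = refl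
  ⊕-self (a ∷ u) = cong₂ _∷_ (BoolP.xor-same a) (⊕-self u)

  ⊕-cancelʳ : ∀ {r} (u v : F₂^ r) → (u ⊕ v) ⊕ v ≡ u
  ⊕-cancelʳ u v = begin
    (u ⊕ v) ⊕ v  ≡⟨ ⊕-assoc u v v ⟩
    u ⊕ (v ⊕ v)  ≡⟨ cong (u ⊕_) (⊕-self v) ⟩
    u ⊕ 0v       ≡⟨ ⊕-identityʳ u ⟩
    u            ∎
    where open ≡-Reasoning

  ⊕-cancelˡ : ∀ {r} (u v : F₂^ r) → (u ⊕ v) ⊕ u ≡ v
  ⊕-cancelˡ u v = trans (cong (_⊕ u) (⊕-comm u v)) (⊕-cancelʳ v u)

  _≟ᵥ_ : ∀ {r} → DecidableEquality (F₂^ r)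
  _≟ᵥ_ = VecP.≡-dec Bool._≟_

  ≤lex-antisym : ∀ {r} (u w : F₂^ r) → u ≤lex w ≡ true → w ≤lex u ≡ true → u ≡ w
  ≤lex-antisym []          []          _ _  = refl
  ≤lex-antisym (false ∷ u) (false ∷ w) p q  = cong (false ∷_) (≤lex-antisym u w p q)
  ≤lex-antisym (true ∷ u)  (true ∷ w)  p q  = cong (true ∷_) (≤lex-antisym u w p q)
  ≤lex-antisym (false ∷ u) (true ∷ w)  _ ()
  ≤lex-antisym (true ∷ u)  (false ∷ w) () _

  length-allVecs : ∀ r → length (allVecs r) ≡ 2 ^ r
  length-allVecs zero    = refl
  length-allVecs (suc r) = begin
    length (map (false ∷_) (allVecs r) ++ map (true ∷_) (allVecs r))
      ≡⟨ ListP.length-++ (map (false ∷_) (allVecs r)) ⟩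
    length (map (false ∷_) (allVecs r)) + length (map (true ∷_) (allVecs r))
      ≡⟨ cong₂ _+_ (ListP.length-map _ (allVecs r)) (ListP.length-map _ (allVecs r)) ⟩
    length (allVecs r) + length (allVecs r)
      ≡⟨ cong (λ l → l + l) (length-allVecs r) ⟩
    2 ^ r + 2 ^ r
      ≡⟨ cong (2 ^ r +_) (sym (ℕP.+-identityʳ _)) ⟩
    2 ^ suc r ∎
    where open ≡-Reasoning

  allVecs-unique : ∀ r → Unique (allVecs r)
  allVecs-unique zero    = [] ∷ []
  allVecs-unique (suc r) =
    UniqueP.++⁺ (UniqueP.map⁺ ∷-injectiveʳ (allVecs-unique r)) (UniqueP.map⁺ ∷-injectiveʳ (allVecs-unique r)) disjoint
    where
    ∷-injectiveʳ : ∀ {b} {u w : F₂^ r} → _≡_ {A = F₂^ (suc r)} (b ∷ u) (b ∷ w) → u ≡ w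
    ∷-injectiveʳ refl = refl
    disjoint : ∀ {v} → ¬ (v ∈ map (false ∷_) (allVecs r) × v ∈ map (true ∷_) (allVecs r))
    disjoint (p , q) with ∈-map⁻ (false ∷_) p | ∈-map⁻ (true ∷_) q
    ... | _ , _ , refl | _ , _ , ()

  count-allVecs-suc : ∀ {r} (p : F₂^ (suc r) → Bool) →
    count p (allVecs (suc r)) ≡ count (p ∘ (false ∷_)) (allVecs r) + count (p ∘ (true ∷_)) (allVecs r)
  count-allVecs-suc {r} p = begin
    count p (map (false ∷_) (allVecs r) ++ map (true ∷_) (allVecs r))
      ≡⟨ count-++ p (map (false ∷_) (allVecs r)) _ ⟩
    count p (map (false ∷_) (allVecs r)) + count p (map (true ∷_) (allVecs r))
      ≡⟨ cong₂ _+_ (count-map p _ (allVecs r)) (count-map p _ (allVecs r)) ⟩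
    count (p ∘ (false ∷_)) (allVecs r) + count (p ∘ (true ∷_)) (allVecs r) ∎
    where open ≡-Reasoning

  sumOver-⊥ : ∀ {n r} (s : Fin n → F₂^ r) → sumOver s ⊥ ≡ 0v
  sumOver-⊥ {zero}  s = refl
  sumOver-⊥ {suc n} s = trans (⊕-identityˡ _) (sumOver-⊥ (s ∘ fsuc))

  sumOver-⁅⁆ : ∀ {n r} (s : Fin n → F₂^ r) l → sumOver s ⁅ l ⁆ ≡ s l
  sumOver-⁅⁆ s fzero    = trans (cong (s fzero ⊕_) (sumOver-⊥ (s ∘ fsuc))) (⊕-identityʳ _)
  sumOver-⁅⁆ s (fsuc l) = trans (⊕-identityˡ _) (sumOver-⁅⁆ (s ∘ fsuc) l)

  subsetOfSize : ∀ n m → m ≤ n → Σ (Subset n) λ X → ∣ X ∣ ≡ m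
  subsetOfSize n       zero    _         = ⊥ , SubsetP.∣⊥∣≡0 n
  subsetOfSize (suc n) (suc m) (s≤s m≤n) with subsetOfSize n m m≤n
  ... | X , ∣X∣≡m = inside ∷ X , cong suc ∣X∣≡m

  subsetOfSize∋ : ∀ {n} m (l : Fin n) → 1 ≤ m → m ≤ n → Σ (Subset n) λ X → ∣ X ∣ ≡ m × l ∈ₛ X
  subsetOfSize∋ 1 l _ _ = ⁅ l ⁆ , SubsetP.∣⁅x⁆∣≡1 l , SubsetP.x∈⁅x⁆ l
  subsetOfSize∋ {suc n} (suc m) fzero _ (s≤s m≤n) with subsetOfSize n m m≤n
  ... | X , ∣X∣≡m = inside ∷ X , cong suc ∣X∣≡m , Data.Vec.here
  subsetOfSize∋ (suc (suc m)) (fsuc l) _ (s≤s m≤n) with subsetOfSize∋ (suc m) l (s≤s z≤n) m≤n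
  ... | X , ∣X∣≡m , l∈X = inside ∷ X , cong suc ∣X∣≡m , Data.Vec.there l∈X

  AnyLinIndep⇒≢0v : ∀ {n r} m (s : Fin n → F₂^ r) → 1 ≤ m → m ≤ n → AnyLinIndep m s → ∀ l → s l ≢ 0v
  AnyLinIndep⇒≢0v {n} m s 1≤m m≤n indep l sl≡0 with subsetOfSize∋ m l 1≤m m≤n
  ... | X , ∣X∣≡m , l∈X = SubsetP.∉⊥ (subst (l ∈ₛ_) ⁅l⁆≡⊥ (SubsetP.x∈⁅x⁆ l))
    where
    ⁅l⁆≡⊥ : ⁅ l ⁆ ≡ ⊥
    ⁅l⁆≡⊥ = indep X ∣X∣≡m ⁅ l ⁆
      (λ i∈⁅l⁆ → subst (_∈ₛ X) (sym (SubsetP.x∈⁅y⁆⇒x≡y l i∈⁅l⁆)) l∈X) (trans (sumOver-⁅⁆ s l) sl≡0)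

  span : ∀ {r} → List (F₂^ r) → List (F₂^ r)
  span []       = 0v ∷ []
  span (u ∷ us) = span us ++ map (u ⊕_) (span us)

  length-span : ∀ {r} (us : List (F₂^ r)) → length (span us) ≡ 2 ^ length us
  length-span []       = refl
  length-span (u ∷ us) = begin
    length (span us ++ map (u ⊕_) (span us))         ≡⟨ ListP.length-++ (span us) ⟩
    length (span us) + length (map (u ⊕_) (span us)) ≡⟨ cong (length (span us) +_) (ListP.length-map (u ⊕_) (span us)) ⟩
    length (span us) + length (span us)              ≡⟨ cong (λ l → l + l) (length-span us) ⟩
    2 ^ length us + 2 ^ length us                    ≡⟨ cong (2 ^ length us +_) (sym (ℕP.+-identityʳ _)) ⟩
    2 ^ suc (length us)                              ∎
    where open ≡-Reasoning

  0∈span : ∀ {r} (us : List (F₂^ r)) → 0v ∈ span us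
  0∈span []       = here refl
  0∈span (u ∷ us) = ∈-++⁺ˡ (0∈span us)

  ∈span-∷ : ∀ {r} (w : F₂^ r) ws {v} → v ∈ span ws → v ∈ span (w ∷ ws)
  ∈span-∷ w ws = ∈-++⁺ˡ

  ⊕∈span-∷ : ∀ {r} (w : F₂^ r) ws {v} → v ∈ span ws → w ⊕ v ∈ span (w ∷ ws)
  ⊕∈span-∷ w ws v∈ = ∈-++⁺ʳ (span ws) (∈-map⁺ (w ⊕_) v∈)

  ∈span-∷⁻ : ∀ {r} (w : F₂^ r) ws {v} → v ∈ span (w ∷ ws) →
             v ∈ span ws ⊎ ∃[ v′ ] v′ ∈ span ws × v ≡ w ⊕ v′
  ∈span-∷⁻ w ws v∈ with ∈-++⁻ (span ws) v∈
  ... | inj₁ v∈ws   = inj₁ v∈ws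
  ... | inj₂ v∈w⊕ws = inj₂ (∈-map⁻ (w ⊕_) v∈w⊕ws)

  ∈span-⊕ : ∀ {r} {u v : F₂^ r} {us} → u ∈ us → v ∈ span us → v ⊕ u ∈ span us
  ∈span-⊕ {u = u} {v} {_ ∷ ws} (here refl) v∈ with ∈span-∷⁻ u ws v∈
  ... | inj₁ v∈ws              = subst (_∈ _) (⊕-comm u v) (⊕∈span-∷ u ws v∈ws)
  ... | inj₂ (v′ , v′∈ , refl) = subst (_∈ _) (sym (⊕-cancelˡ u v′)) (∈span-∷ u ws v′∈)
  ∈span-⊕ {u = u} {us = w ∷ ws} (there u∈) v∈ with ∈span-∷⁻ w ws v∈
  ... | inj₁ v∈ws              = ∈span-∷ w ws (∈span-⊕ u∈ v∈ws)
  ... | inj₂ (v′ , v′∈ , refl) = subst (_∈ _) (sym (⊕-assoc w v′ u)) (⊕∈span-∷ w ws (∈span-⊕ u∈ v′∈))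

  ∈span-⊕⁻ : ∀ {r} {u v : F₂^ r} {us} → u ∈ us → v ⊕ u ∈ span us → v ∈ span us
  ∈span-⊕⁻ {u = u} {v} u∈ v⊕u∈ = subst (_∈ _) (⊕-cancelʳ v u) (∈span-⊕ u∈ v⊕u∈)

  ∈span-─ : ∀ {r} {u v : F₂^ r} {us} (u∈ : u ∈ us) → v ∈ span us →
            v ∈ span (us ─ u∈) ⊎ v ⊕ u ∈ span (us ─ u∈)
  ∈span-─ {u = u} {us = _ ∷ ws} (here refl) v∈ with ∈span-∷⁻ u ws v∈
  ... | inj₁ v∈ws              = inj₁ v∈ws
  ... | inj₂ (v′ , v′∈ , refl) = inj₂ (subst (_∈ _) (sym (⊕-cancelˡ u v′)) v′∈)
  ∈span-─ {u = u} {us = w ∷ ws} (there u∈) v∈ with ∈span-∷⁻ w ws v∈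
  ... | inj₁ v∈ws = Sum.map (∈span-∷ w (ws ─ u∈)) (∈span-∷ w (ws ─ u∈)) (∈span-─ u∈ v∈ws)
  ... | inj₂ (v′ , v′∈ , refl) with ∈span-─ u∈ v′∈
  ...   | inj₁ v′∈─   = inj₁ (⊕∈span-∷ w (ws ─ u∈) v′∈─)
  ...   | inj₂ v′⊕u∈─ = inj₂ (subst (_∈ _) (sym (⊕-assoc w v′ u)) (⊕∈span-∷ w (ws ─ u∈) v′⊕u∈─))

  -- Code.isRep s (v , l) is isRepOf (s l) v
  isRepOf : ∀ {r} → F₂^ r → F₂^ r → Bool
  isRepOf u v = v ≤lex (v ⊕ u)

  double-count-isRepOf : ∀ {r} (u : F₂^ r) → u ≢ 0v → 2 * count (isRepOf u) (allVecs r) ≡ 2 ^ r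
  double-count-isRepOf []               u≢0 = ⊥-elim (u≢0 refl)
  double-count-isRepOf {suc r} (true ∷ u) _ = begin
    2 * count (isRepOf (true ∷ u)) (allVecs (suc r))
      ≡⟨ cong (2 *_) (count-allVecs-suc (isRepOf (true ∷ u))) ⟩
    2 * (count (λ _ → true) (allVecs r) + count (λ _ → false) (allVecs r))
      ≡⟨ cong₂ (λ a b → 2 * (a + b)) (trans (count-true (allVecs r)) (length-allVecs r)) (count-false (allVecs r)) ⟩
    2 * (2 ^ r + 0)
      ≡⟨ cong (2 *_) (ℕP.+-identityʳ (2 ^ r)) ⟩
    2 ^ suc r ∎
    where open ≡-Reasoning
  double-count-isRepOf {suc r} (false ∷ u) u≢0 = begin
    2 * count (isRepOf (false ∷ u)) (allVecs (suc r))
      ≡⟨ cong (2 *_) (count-allVecs-suc (isRepOf (false ∷ u))) ⟩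
    2 * (count (isRepOf u) (allVecs r) + count (isRepOf u) (allVecs r))
      ≡⟨ ℕP.*-distribˡ-+ 2 (count (isRepOf u) (allVecs r)) _ ⟩
    2 * count (isRepOf u) (allVecs r) + 2 * count (isRepOf u) (allVecs r)
      ≡⟨ cong (λ c → c + c) (double-count-isRepOf u (u≢0 ∘ cong (false ∷_))) ⟩
    2 ^ r + 2 ^ r
      ≡⟨ cong (2 ^ r +_) (sym (ℕP.+-identityʳ _)) ⟩
    2 ^ suc r ∎
    where open ≡-Reasoning

  double-numClasses : ∀ {c ℓ} (F : FiniteField c ℓ) {n r} (s : Fin n → F₂^ r) →
    (∀ l → s l ≢ 0v) → 2 * Code.numClasses F s ≡ n * 2 ^ r
  double-numClasses F {n} {r} s s≢0 = begin
    2 * count (Code.isRep F s) (Code.allPairs F r n)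
      ≡⟨ cong (2 *_) (count-pairs (Code.isRep F s) (allVecs r) (allFin n)) ⟩
    2 * sum (map (λ l → count (isRepOf (s l)) (allVecs r)) (allFin n))
      ≡⟨ *-sum-map-const _ 2 (2 ^ r) (λ l → double-count-isRepOf (s l) (s≢0 l)) (allFin n) ⟩
    length (allFin n) * 2 ^ r
      ≡⟨ cong (_* 2 ^ r) (length-allFin n) ⟩
    n * 2 ^ r ∎
    where open ≡-Reasoning

  rep : ∀ {r} → F₂^ r → F₂^ r → F₂^ r
  rep u w = if isRepOf u w then w else w ⊕ u

  rep-self : ∀ {r} (u v : F₂^ r) → isRepOf u v ≡ true → rep u v ≡ v
  rep-self u v v≤v⊕u rewrite v≤v⊕u = refl

  rep-⊕ : ∀ {r} (u v : F₂^ r) → isRepOf u v ≡ true → rep u (v ⊕ u) ≡ v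
  rep-⊕ u v v≤v⊕u with isRepOf u (v ⊕ u) in v⊕u≤v
  ... | true  = sym (≤lex-antisym v (v ⊕ u) v≤v⊕u (subst (λ w → (v ⊕ u) ≤lex w ≡ true) (⊕-cancelʳ v u) v⊕u≤v))
  ... | false = ⊕-cancelʳ v u

  -- rep u maps span (us ─ u∈) onto the representatives lying in span us
  count-isRepOf-span : ∀ {r} {u : F₂^ r} {us} (p : F₂^ r → Bool) → u ∈ us →
    (∀ v → p v ≡ true → isRepOf u v ≡ true × v ∈ span us) → count p (allVecs r) ≤ 2 ^ pred (length us)
  count-isRepOf-span {r} {u} {us} p u∈ sound = begin
    count p (allVecs r)                    ≤⟨ count≤length p (allVecs-unique r) rep∈ ⟩
    length (map (rep u) (span (us ─ u∈)))  ≡⟨ ListP.length-map (rep u) (span (us ─ u∈)) ⟩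
    length (span (us ─ u∈))                ≡⟨ length-span (us ─ u∈) ⟩
    2 ^ length (us ─ u∈)                   ≡⟨ cong (2 ^_) (ListP.length-removeAt us _) ⟩
    2 ^ pred (length us)                   ∎
    where
    open ℕP.≤-Reasoning
    rep∈ : ∀ {v} → v ∈ allVecs r → p v ≡ true → v ∈ map (rep u) (span (us ─ u∈))
    rep∈ {v} _ pv with sound v pv
    ... | isRep , v∈ with ∈span-─ u∈ v∈
    ...   | inj₁ v∈─   = subst (_∈ _) (rep-self u v isRep) (∈-map⁺ (rep u) v∈─)
    ...   | inj₂ v⊕u∈─ = subst (_∈ _) (rep-⊕ u v isRep) (∈-map⁺ (rep u) v⊕u∈─)

  parameters : ∀ {n r d k} → r ≤ n → d ≤ suc r → k ≤ n → n ∸ k + 1 ≡ d ∸ 1 →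
    1 ≤ d ∸ 1 × d ∸ 1 ≤ r × (d ∸ 1) + (k ∸ 1) ≡ n × k ∸ 1 < k
  parameters {n} {r} {d} {zero} r≤n d≤1+r _ n+1≡m = ⊥-elim (ℕP.n≮n n (begin-strict
    n      <⟨ ℕP.n<1+n n ⟩
    suc n  ≡⟨ trans (ℕP.+-comm 1 n) n+1≡m ⟩
    d ∸ 1  ≤⟨ ℕP.∸-monoˡ-≤ 1 d≤1+r ⟩
    r      ≤⟨ r≤n ⟩
    n      ∎))
    where open ℕP.≤-Reasoning
  parameters {n} {r} {d} {suc t} r≤n d≤1+r k≤n n-k+1≡m =
    subst (1 ≤_) n-k+1≡m (ℕP.m≤n+m 1 (n ∸ suc t)) , ℕP.∸-monoˡ-≤ 1 d≤1+r , m+t≡n , ℕP.n<1+n t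
    where
    open ≡-Reasoning
    m+t≡n : d ∸ 1 + t ≡ n
    m+t≡n = begin
      d ∸ 1 + t            ≡⟨ cong (_+ t) n-k+1≡m ⟨
      n ∸ suc t + 1 + t    ≡⟨ ℕP.+-assoc (n ∸ suc t) 1 t ⟩
      n ∸ suc t + suc t    ≡⟨ ℕP.m∸n+n≡m k≤n ⟩
      n                    ∎

  1+m∸n≡m∸[n∸1] : ∀ m {n} → 1 ≤ n → suc m ∸ n ≡ m ∸ (n ∸ 1)
  1+m∸n≡m∸[n∸1] m (s≤s z≤n) = refl

  weight-bound : ∀ {a b m r} n → 1 ≤ m → m ≤ r → a ≤ m * 2 ^ pred m → 2 * b ≡ n * 2 ^ r →
                 a * 2 ^ (r ∸ m) * n ≤ m * b
  weight-bound {a} {b} {suc m} {r} n _ m<r a≤ 2b≡n2ʳ = ℕP.*-cancelˡ-≤ 2 (begin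
    2 * (a * 2 ^ (r ∸ suc m) * n)              ≤⟨ ℕP.*-monoʳ-≤ 2 (ℕP.*-monoˡ-≤ n (ℕP.*-monoˡ-≤ (2 ^ (r ∸ suc m)) a≤)) ⟩
    2 * (suc m * 2 ^ m * 2 ^ (r ∸ suc m) * n)  ≡⟨ rearrange (suc m) (2 ^ m) (2 ^ (r ∸ suc m)) n ⟩
    suc m * (2 ^ suc m * 2 ^ (r ∸ suc m) * n)  ≡⟨ cong (λ e → suc m * (e * n)) (ℕP.^-distribˡ-+-* 2 (suc m) (r ∸ suc m)) ⟨
    suc m * (2 ^ (suc m + (r ∸ suc m)) * n)    ≡⟨ cong (λ e → suc m * (2 ^ e * n)) (ℕP.m+[n∸m]≡n m<r) ⟩
    suc m * (2 ^ r * n)                        ≡⟨ cong (suc m *_) (trans (ℕP.*-comm (2 ^ r) n) (sym 2b≡n2ʳ)) ⟩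
    suc m * (2 * b)                            ≡⟨ x[2y]≡2[xy] (suc m) b ⟩
    2 * (suc m * b)                            ∎)
    where
    open ℕP.≤-Reasoning
    rearrange : ∀ m x y n → 2 * (m * x * y * n) ≡ m * (2 * x * y * n)
    rearrange = solve-∀
    x[2y]≡2[xy] : ∀ x y → x * (2 * y) ≡ 2 * (x * y)
    x[2y]≡2[xy] = solve-∀

module Fractions where
  open import Data.Nat as ℕ using (suc; NonZero)
  import Data.Nat.Properties as ℕP
  open import Data.Integer as ℤ using (ℤ; +_)
  import Data.Integer.Properties as ℤP
  open import Data.Integer.Tactic.RingSolver using (solve-∀)
  open import Data.Rational using (1ℚ; _*_; _-_; _≤_; toℚᵘ)
  import Data.Rational
  open import Data.Rational.Properties
    using (toℚᵘ-cancel-≤; toℚᵘ-homo-*; toℚᵘ-homo-+; toℚᵘ-homo‿-; toℚᵘ-fromℚᵘ)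
  open import Data.Rational.Unnormalised as ℚᵘ using (ℚᵘ; mkℚᵘ; *≤*; ↥_; ↧_)
  import Data.Rational.Unnormalised.Properties as ℚᵘP
  open import Relation.Binary.PropositionalEquality using (_≢_; sym; trans; cong; subst; subst₂)
  open Combinatorics using (double-numClasses; weight-bound)

  -- in ℚᵘ the numerator and denominator can be read off without gcd normalisation
  private
    bound : ℕ → ℕ → ℕ → ℚᵘ
    bound p k n = mkℚᵘ (+ 1) p ℚᵘ.* (mkℚᵘ (+ 1) 0 ℚᵘ.- mkℚᵘ (+ k) n)

    toℚᵘ-bound : ∀ p k n → toℚᵘ ((1 /ℕ suc p) * (1ℚ - (k /ℕ suc n))) ℚᵘ.≃ bound p k n
    toℚᵘ-bound p k n =
      ℚᵘP.≃-trans (toℚᵘ-homo-* (1 /ℕ suc p) (1ℚ - (k /ℕ suc n))) (ℚᵘP.*-cong (toℚᵘ-fromℚᵘ (mkℚᵘ (+ 1) p))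
        (ℚᵘP.≃-trans (toℚᵘ-homo-+ 1ℚ (Data.Rational.- (k /ℕ suc n))) (ℚᵘP.+-cong (toℚᵘ-fromℚᵘ (mkℚᵘ (+ 1) 0))
          (ℚᵘP.≃-trans (toℚᵘ-homo‿- (k /ℕ suc n)) (ℚᵘP.-‿cong (toℚᵘ-fromℚᵘ (mkℚᵘ (+ k) n)))))))

    ↥-bound : ∀ p k n m → m ℕ.+ k ≡ suc n → ↥ bound p k n ≡ + m
    ↥-bound p k n m m+k≡n = trans (cong (λ z → + 1 ℤ.* (+ 1 ℤ.* z ℤ.+ (ℤ.- + k) ℤ.* + 1)) n≡m+k) (cancel (+ m) (+ k))
      where
      n≡m+k : + suc n ≡ + m ℤ.+ + k
      n≡m+k = trans (cong +_ (sym m+k≡n)) (ℤP.pos-+ m k)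
      cancel : ∀ a b → + 1 ℤ.* (+ 1 ℤ.* (a ℤ.+ b) ℤ.+ (ℤ.- b) ℤ.* + 1) ≡ a
      cancel = solve-∀

    ↧-bound : ∀ p k n → ↧ bound p k n ≡ + (suc p ℕ.* suc n)
    ↧-bound p k n = cong (λ z → + (suc p ℕ.* z)) (ℕP.*-identityˡ (suc n))

  /ℕ-≤-*-complement : ∀ a b p n m k .{{_ : NonZero b}} .{{_ : NonZero p}} .{{_ : NonZero n}} →
    m ℕ.+ k ≡ n → a ℕ.* p ℕ.* n ℕ.≤ m ℕ.* b → a /ℕ b ≤ (1 /ℕ p) * (1ℚ - (k /ℕ n))
  /ℕ-≤-*-complement a (suc b) (suc p) (suc n) m k m+k≡n apn≤mb =
    toℚᵘ-cancel-≤ (ℚᵘP.≤-respʳ-≃ (ℚᵘP.≃-sym (toℚᵘ-bound p k n))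
                  (ℚᵘP.≤-respˡ-≃ (ℚᵘP.≃-sym (toℚᵘ-fromℚᵘ (mkℚᵘ (+ a) b))) (*≤* cross)))
    where
    cross : + a ℤ.* ↧ bound p k n ℤ.≤ ↥ bound p k n ℤ.* + suc b
    cross = subst₂ (λ x y → + a ℤ.* y ℤ.≤ x ℤ.* + suc b) (sym (↥-bound p k n m m+k≡n)) (sym (↧-bound p k n))
              (subst₂ ℤ._≤_ (ℤP.pos-* a (suc p ℕ.* suc n)) (ℤP.pos-* m (suc b))
                (ℤ.+≤+ (subst (ℕ._≤ m ℕ.* suc b) (ℕP.*-assoc a (suc p) (suc n)) apn≤mb)))

  relWeight≤ : ∀ {c ℓ} (F : FiniteField c ℓ) {n r m t} (s : Fin n → F₂^ r) (f : Code.Fn F r n) →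
    1 ℕ.≤ m → m ℕ.≤ r → m ℕ.+ t ≡ n → (∀ l → s l ≢ 0v) →
    Code.numNonzeroClasses F s f ℕ.≤ m ℕ.* 2 ℕ.^ ℕ.pred m →
    Code.relWeight F s f ≤ (1 /ℕ (2 ℕ.^ (r ℕ.∸ m))) * (1ℚ - (t /ℕ n))
  relWeight≤ F {n} {r} {m} {t} s f 1≤m m≤r m+t≡n s≢0v N≤ =
    /ℕ-≤-*-complement _ (Code.numClasses F s) (2 ℕ.^ (r ℕ.∸ m)) n m t
      {{numClasses≢0}} {{ℕP.m^n≢0 2 (r ℕ.∸ m)}} {{n≢0}} m+t≡n (weight-bound n 1≤m m≤r N≤ classes)
    where
    classes : 2 ℕ.* Code.numClasses F s ≡ n ℕ.* 2 ℕ.^ r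
    classes = double-numClasses F s s≢0v
    n≢0 : NonZero n
    n≢0 = ℕ.>-nonZero (subst (1 ℕ.≤_) m+t≡n (ℕP.≤-trans 1≤m (ℕP.m≤m+n m t)))
    numClasses≢0 : NonZero (Code.numClasses F s)
    numClasses≢0 = ℕP.m*n≢0⇒n≢0 2 {{subst NonZero (sym classes) (ℕP.m*n≢0 n (2 ℕ.^ r) {{n≢0}} {{ℕP.m^n≢0 2 r}})}}

module CodewordOnSupport {c ℓ} (F : FiniteField c ℓ) {n r : ℕ}
  (x : Fin n → FiniteField.Carrier F) (x-injective : ∀ i j → FiniteField._≈_ F (x i) (x j) → i ≡ j)
  (s : Fin n → F₂^ r) (inSupport : Fin n → Bool) where

  open import Data.Bool using (true; false; if_then_else_; not; _∧_; T; T?)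
  import Data.Bool.Properties as BoolP
  open import Data.Nat using (suc; pred; _*_; _^_; _≤_; _<_)
  import Data.Nat.Properties as ℕP
  open import Data.Nat.ListAction using (sum)
  open import Data.List using (List; map; length; filterᵇ; allFin)
  import Data.List.Properties as ListP
  open import Data.List.Membership.Propositional using (_∈_)
  open import Data.List.Membership.Propositional.Properties using (∈-map⁺; ∈-map⁻; ∈-filter⁺; ∈-filter⁻; ∈-allFin)
  open import Data.Product using (_×_; _,_; proj₁; proj₂)
  open import Data.Empty using (⊥-elim)
  open import Function using (_∘_)
  open import Function.Bundles using (_⇔_; mk⇔)
  open import Relation.Nullary using (¬_; does; yes; no)
  open import Relation.Nullary.Decidable using (dec-true; dec-false; does-⇔; decidable-stable)
  open import Relation.Binary.PropositionalEquality using (refl; sym; trans; cong; subst)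

  open FiniteField F using (Carrier; _≈_; 0#; _≟_; reflexive) renaming (refl to ≈-refl; sym to ≈-sym; trans to ≈-trans)
  open Code F
  open Combinatorics
  open Polynomial F
    using (eval; vanishingPoly; length-vanishingPoly; eval-vanishingPoly-root; eval-vanishingPoly-nonroot; eval∈RS; 0∈RS)
  open import Data.List.Membership.DecPropositional (_≟ᵥ_ {r}) using (_∈?_)

  support rootIndices : List (Fin n)
  support     = filterᵇ inSupport (allFin n)
  rootIndices = filterᵇ (not ∘ inSupport) (allFin n)

  U : List (F₂^ r)
  U = span (map s support)

  g : List Carrier
  g = vanishingPoly (map x rootIndices)

  |support| : ℕ
  |support| = count inSupport (allFin n)

  length-s[support] : length (map s support) ≡ |support|
  length-s[support] = trans (ListP.length-map s support) (length-filterᵇ inSupport (allFin n))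

  length-x[rootIndices] : length (map x rootIndices) ≡ count (not ∘ inSupport) (allFin n)
  length-x[rootIndices] = trans (ListP.length-map x rootIndices) (length-filterᵇ (not ∘ inSupport) (allFin n))

  row : Bool → Fin n → Carrier
  row true  l = eval g (x l)
  row false l = 0#

  codeword : Fn r n
  codeword v = row (does (v ∈? U))

  ∈support : ∀ {l} → inSupport l ≡ true → l ∈ support
  ∈support e = ∈-filter⁺ (T? ∘ inSupport) (∈-allFin _) (subst T (sym e) _)

  ∈rootIndices : ∀ {l} → inSupport l ≡ false → l ∈ rootIndices
  ∈rootIndices e = ∈-filter⁺ (T? ∘ not ∘ inSupport) (∈-allFin _) (subst (T ∘ not) (sym e) _)

  row-outside-support : ∀ {l} → inSupport l ≡ false → ∀ b → row b l ≈ 0#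
  row-outside-support l∉ true  = eval-vanishingPoly-root (∈-map⁺ x (∈rootIndices l∉))
  row-outside-support l∉ false = ≈-refl

  row-support : ∀ {l} → inSupport l ≡ true → ¬ row true l ≈ 0#
  row-support {l} l∈ = eval-vanishingPoly-nonroot (map x rootIndices) x∉
    where
    x∉ : ∀ {a} → a ∈ map x rootIndices → ¬ x l ≈ a
    x∉ a∈ xl≈a with ∈-map⁻ x a∈
    ... | j , j∈ , refl with x-injective l j xl≈a
    ...   | refl = subst (T ∘ not) l∈ (proj₂ (∈-filter⁻ (T? ∘ not ∘ inSupport) {xs = allFin n} j∈))

  ∈U⇔⊕∈U : ∀ {l} → inSupport l ≡ true → ∀ v → v ∈ U ⇔ v ⊕ s l ∈ U
  ∈U⇔⊕∈U l∈ v = mk⇔ (∈span-⊕ sl∈) (∈span-⊕⁻ sl∈)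
    where sl∈ = ∈-map⁺ s (∈support l∈)

  codeword-∈W : InW s codeword
  codeword-∈W v l with inSupport l in e
  ... | true  = reflexive (cong (λ b → row b l) (does-⇔ (∈U⇔⊕∈U e v) (v ∈? U) ((v ⊕ s l) ∈? U)))
  ... | false = ≈-trans (row-outside-support e (does (v ∈? U)))
                        (≈-sym (row-outside-support e (does ((v ⊕ s l) ∈? U))))

  codeword-∈Code : ∀ k → count (not ∘ inSupport) (allFin n) < k → InCode k x s codeword
  codeword-∈Code k |R|<k = codeword-∈W , λ v → row∈RS (does (v ∈? U))
    where
    length-g≤k : length g ≤ k
    length-g≤k = ℕP.≤-trans (length-vanishingPoly (map x rootIndices))
                            (subst (λ m → suc m ≤ k) (sym length-x[rootIndices]) |R|<k)
    row∈RS : ∀ b → InRS k x (row b)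
    row∈RS true  = eval∈RS x g length-g≤k
    row∈RS false = 0∈RS k x

  codeword-nonzero : ∀ {l} → inSupport l ≡ true → Nonzero codeword
  codeword-nonzero {l} l∈ =
    0v , l , subst (λ b → ¬ row b l ≈ 0#) (sym (dec-true (0v ∈? U) (0∈span (map s support)))) (row-support l∈)

  ∈U-of-nonzero : ∀ {v l} → ¬ codeword v l ≈ 0# → v ∈ U
  ∈U-of-nonzero {v} {l} f≉0 =
    decidable-stable (v ∈? U) λ v∉U → f≉0 (reflexive (cong (λ b → row b l) (dec-false (v ∈? U) v∉U)))

  nonzeroRep : F₂^ r × Fin n → Bool
  nonzeroRep p = isRep s p ∧ not (does (codeword (proj₁ p) (proj₂ p) ≟ 0#))

  nonzeroRep-sound : ∀ l v → nonzeroRep (v , l) ≡ true → isRepOf (s l) v ≡ true × v ∈ U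
  nonzeroRep-sound l v _  with isRepOf (s l) v | codeword v l ≟ 0#
  nonzeroRep-sound l v () | false | _
  nonzeroRep-sound l v () | true  | yes _
  nonzeroRep-sound l v _  | true  | no f≉0 = refl , ∈U-of-nonzero f≉0

  nonzeroRep-outside-support : ∀ {l} → inSupport l ≡ false → ∀ v → nonzeroRep (v , l) ≡ false
  nonzeroRep-outside-support {l} l∉ v with codeword v l ≟ 0#
  ... | yes _  = BoolP.∧-zeroʳ _
  ... | no f≉0 = ⊥-elim (f≉0 (row-outside-support l∉ (does (v ∈? U))))

  count-nonzeroRep≤ : ∀ l →
    count (λ v → nonzeroRep (v , l)) (allVecs r) ≤ (if inSupport l then 2 ^ pred |support| else 0)
  count-nonzeroRep≤ l with inSupport l in e
  ... | false = ℕP.≤-reflexive (trans (count-cong (nonzeroRep-outside-support e) (allVecs r)) (count-false (allVecs r)))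
  ... | true  = subst (λ m → count (λ v → nonzeroRep (v , l)) (allVecs r) ≤ 2 ^ pred m) length-s[support]
                  (count-isRepOf-span _ (∈-map⁺ s (∈support e)) (nonzeroRep-sound l))

  numNonzeroClasses-codeword≤ : ∀ {m} → |support| ≡ m → numNonzeroClasses s codeword ≤ m * 2 ^ pred m
  numNonzeroClasses-codeword≤ {m} refl = begin
    count nonzeroRep (allPairs r n)
      ≡⟨ count-pairs nonzeroRep (allVecs r) (allFin n) ⟩
    sum (map (λ l → count (λ v → nonzeroRep (v , l)) (allVecs r)) (allFin n))
      ≤⟨ sum-map-mono-≤ count-nonzeroRep≤ (allFin n) ⟩
    sum (map (λ l → if inSupport l then 2 ^ pred |support| else 0) (allFin n))
      ≡⟨ sum-map-if inSupport (2 ^ pred |support|) (allFin n) ⟩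
    |support| * 2 ^ pred |support| ∎
    where open ℕP.≤-Reasoning

open import Data.Nat using (suc; _+_; _∸_; _^_; _≤_; _<_; _≤ᵇ_)
import Data.Nat.Properties as ℕP
open import Data.Fin using (toℕ)
open import Data.Product using (Σ; _×_; _,_; proj₂)
open import Data.Rational using (1ℚ; _*_; _-_) renaming (_≤_ to _≤ℚ_)
open import Relation.Binary.PropositionalEquality using (_≢_; sym; subst)
open Combinatorics using (parameters; threshold-count; threshold-count-not; threshold-last; 1+m∸n≡m∸[n∸1]; AnyLinIndep⇒≢0v)
open Fractions using (relWeight≤)

mainTheorem7 : ∀ {c ℓ} (F : FiniteField c ℓ) (n r d k : ℕ)
    → 1 ≤ r → r ≤ n → 1 ≤ d → d ≤ suc r → k ≤ n
    → n ∸ k + 1 ≡ d ∸ 1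
    → n < FiniteField.card F
    → (x : Fin n → FiniteField.Carrier F)
    → (∀ i j → FiniteField._≈_ F (x i) (x j) → i ≡ j)
    → (s : Fin n → F₂^ r)
    → (∀ i j → s i ≡ s j → i ≡ j)
    → Spans s
    → AnyLinIndep (d ∸ 1) s
    → Σ (Code.Fn F r n) λ f →
        Code.InCode F k x s f × Code.Nonzero F f
        × (Code.relWeight F s f ≤ℚ ((1 /ℕ (2 ^ (suc r ∸ d))) * (1ℚ - ((k ∸ 1) /ℕ n))))
mainTheorem7 F n r d k _ r≤n 1≤d d≤1+r k≤n n-k+1≡d-1 _ x x-injective s _ _ independent
  with parameters r≤n d≤1+r k≤n n-k+1≡d-1
... | 1≤m , m≤r , m+t≡n , t<k =
  codeword ,
  codeword-∈Code k (subst (_< k) (sym (threshold-count-not {t = k ∸ 1} m+t≡n)) t<k) ,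
  codeword-nonzero (proj₂ (threshold-last {t = k ∸ 1} 1≤m m+t≡n)) ,
  subst (λ e → relWeight s codeword ≤ℚ (1 /ℕ (2 ^ e)) * (1ℚ - ((k ∸ 1) /ℕ n))) (sym (1+m∸n≡m∸[n∸1] r 1≤d))
    (relWeight≤ F s codeword 1≤m m≤r m+t≡n s≢0v (numNonzeroClasses-codeword≤ (threshold-count {t = k ∸ 1} m+t≡n)))
  where
  open Code F using (relWeight)
  open CodewordOnSupport F x x-injective s (λ l → (k ∸ 1) ≤ᵇ toℕ l)
  s≢0v : ∀ l → s l ≢ 0v
  s≢0v = AnyLinIndep⇒≢0v (d ∸ 1) s 1≤m (ℕP.≤-trans m≤r r≤n) independent
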